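{- Let $w\in\{0,1\}^{\omega}$ contain infinitely many $0$'s and infinitely many $1$'s. Then for every $p>0$ there exists $N$ such that $d_n(w)>n^p$ for all $n\ge N$.
   Context: $\{0,1\}^{\omega}$ is the set of infinite binary words $w=w_1w_2\cdots$, $w[k]=w_1\cdots w_k$. For $\pi\in\mathfrak{S}_n$, $\mathrm{Des}(\pi)=x_1\cdots x_{n-1}$ with $x_i=1$ iff $\pi_i>\pi_{i+1}$, and $d_n(w)$ is the number of $\pi\in\mathfrak{S}_n$ with $\mathrm{Des}(\pi)=w[n-1]$.
   Formalization: The exponent p ranges over the positive rationals. -}

module Defs where

open import Data.Bool using (Bool; true; false)
open import Data.Nat using (ℕ; zero; suc; _<ᵇ_; _∸_; _≤_)
open import Data.Fin using (Fin; toℕ)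
import Data.Fin.Properties as FinP
open import Data.List using (List; []; _∷_; map; filter; length; concatMap; allFin; upTo)
import Data.List.Properties as ListP
import Data.Bool.Properties as BoolP
open import Data.Vec using (Vec; []; _∷_; toList)
open import Data.Product using (_×_; ∃)
open import Relation.Nullary.Decidable using (_×-dec_)
open import Relation.Binary.PropositionalEquality using (_≡_)
open import Data.List.Relation.Unary.Unique.Propositional using (Unique)
import Data.List.Relation.Unary.Unique.DecPropositional as UDec

-- An infinite binary word w = w₁ w₂ ⋯ ∈ {0,1}^ω, represented as ℕ → Bool,
-- with  w k  the letter w_{k+1}  (false = 0, true = 1).
Word : Set
Word = ℕ → Bool

prefix : Word → ℕ → List Bool
prefix w k = map w (upTo k)

allVecs : (n k : ℕ) → List (Vec (Fin n) k)
allVecs n zero = [] ∷ []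
allVecs n (suc k) = concatMap (λ x → map (x ∷_) (allVecs n k)) (allFin n)

-- A permutation π ∈ 𝔖ₙ in one-line notation π₁ ⋯ πₙ (values in Fin n = {0,…,n-1}):
-- a vector of length n with pairwise distinct entries.
IsPerm : {n : ℕ} → Vec (Fin n) n → Set
IsPerm v = Unique (toList v)

desList : {n : ℕ} → List (Fin n) → List Bool
desList [] = []
desList (x ∷ []) = []
desList (x ∷ y ∷ r) = (toℕ y <ᵇ toℕ x) ∷ desList (y ∷ r)

Des : {n k : ℕ} → Vec (Fin n) k → List Bool
Des v = desList (toList v)

-- d_n(w) = #{ π ∈ 𝔖ₙ : Des(π) = w[n-1] }
d : ℕ → Word → ℕ
d n w = length (filter (λ v → UDec.unique? (FinP._≟_ {n}) (toList v) ×-dec ListP.≡-dec BoolP._≟_ (Des v) (prefix w (n ∸ 1)))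
                       (allVecs n n))

InfinitelyMany : Bool → Word → Set
InfinitelyMany b w = ∀ m → ∃ λ k → (m ≤ k) × (w k ≡ b)

-- Build permutations by appending a new last value j and shifting the old values ≥ j up. The new
-- letter is a descent iff j ≤ ℓ, the old last value, so the room for the next letter (the number of
-- admissible j, minus one) is ℓ for a descent and n − ℓ for an ascent. While the letter repeats, a
-- permutation with room ≥ g + 1 has two children with room ≥ g, told apart by their last value, and
-- one with room ≥ g has one; at a change of letter the room can be made maximal. Starting from a
-- change of letter at a position t ≥ a, where the room is t + 1, the numbers f m g of such
-- permutations after m more steps obey the Pascal recurrence f (m + 1) g ≥ f m g + f m (g + 1), so
-- f m (t − a) ≥ (m / (a + 1)) ^ (a + 1). Hence d_n(w) grows at least like n^(a+1), which eventually
-- beats n^a.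
module Submission where

open import Defs
open import Data.Bool using (Bool; true; false; not; if_then_else_)
open import Data.Bool.Properties using (¬-not) renaming (_≟_ to _≟ᵇ_)
open import Data.Nat using (ℕ; zero; suc; _+_; _*_; _∸_; _^_; _≤_; _<_; _≤ᵇ_; _<ᵇ_; _/_; _%_; z≤n; s≤s; s≤s⁻¹; >-nonZero; _≤′_; ≤′-refl; ≤′-step)
import Data.Nat.Properties as ℕ
open import Algebra.Properties.CommutativeSemigroup ℕ.*-commutativeSemigroup using () renaming (interchange to *-interchange)
open import Data.Nat.DivMod using (m≡m%n+[m/n]*n; m%n<n; m*n/n≡m; m/n*n≤m; /-monoˡ-≤)
open import Data.Fin using (Fin; zero; suc; toℕ; fromℕ<; punchIn)
import Data.Fin.Properties as Fin
open import Data.List using (List; []; _∷_; _++_; [_]; length; map; concatMap; allFin; upTo)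
import Data.List.Properties as List
open import Data.List.Membership.Propositional using (_∈_)
open import Data.List.Membership.Propositional.Properties using (∈-map⁺; ∈-map⁻; ∈-allFin; ∈-filter⁺)
open import Data.List.Relation.Binary.Subset.Propositional using (_⊆_)
open import Data.List.Relation.Unary.Any as Any using (here; there; _─_)
open import Data.List.Relation.Unary.Any.Properties using (concatMap⁺)
open import Data.List.Relation.Unary.All as All using (All; []; _∷_)
open import Data.List.Relation.Unary.All.Properties using (++⁺; map⁺)
open import Data.List.Relation.Unary.Unique.Propositional using (Unique)
import Data.List.Relation.Unary.Unique.Propositional.Properties as Unique
import Data.List.Relation.Unary.Unique.DecPropositional as UniqueDec
open import Data.List.Relation.Unary.AllPairs using ([]; _∷_)
open import Data.List.Relation.Binary.Disjoint.Propositional using (Disjoint)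
open import Data.Vec using (Vec; []; _∷_; toList; _∷ʳ_; last) renaming (map to vmap)
import Data.Vec.Properties as Vec
open import Data.Product using (_×_; _,_; proj₁; proj₂; ∃)
open import Function.Base using (_∘_)
open import Function.Bundles using (_⇔_; mk⇔)
open import Relation.Binary.Definitions using (DecidableEquality)
open import Relation.Nullary using (yes; no; contradiction)
open import Relation.Nullary.Reflects using (ofʸ; ofⁿ)
open import Relation.Nullary.Decidable using (_×-dec_; does-⇔; dec-true; dec-false)
open import Relation.Binary.PropositionalEquality
  using (_≡_; _≢_; refl; sym; trans; cong; cong₂; subst; subst₂; module ≡-Reasoning)

module _ {A : Set} where

  ∈-─⁺ : ∀ {x z : A} {ys} (x∈ys : x ∈ ys) → z ∈ ys → z ≢ x → z ∈ (ys ─ x∈ys)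
  ∈-─⁺ (here refl) (here refl) z≢x = contradiction refl z≢x
  ∈-─⁺ (here refl) (there z∈ys) _  = z∈ys
  ∈-─⁺ (there _)   (here refl) _   = here refl
  ∈-─⁺ (there x∈ys) (there z∈ys) z≢x = there (∈-─⁺ x∈ys z∈ys z≢x)

  Unique-⊆⇒length≤ : ∀ {xs ys : List A} → Unique xs → xs ⊆ ys → length xs ≤ length ys
  Unique-⊆⇒length≤ {[]} _ _ = z≤n
  Unique-⊆⇒length≤ {x ∷ xs} {ys} (x∉xs ∷ xs!) xs⊆ys =
    subst (suc (length xs) ≤_) (sym (List.length-removeAt′ ys (Any.index x∈ys)))
      (s≤s (Unique-⊆⇒length≤ xs! λ z∈xs →
        ∈-─⁺ x∈ys (xs⊆ys (there z∈xs)) (λ { refl → All.lookup x∉xs z∈xs refl })))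
    where
    x∈ys : x ∈ ys
    x∈ys = xs⊆ys (here refl)

∈-allVecs : ∀ {n k} (v : Vec (Fin n) k) → v ∈ allVecs n k
∈-allVecs [] = here refl
∈-allVecs {n} {suc k} (x ∷ v) =
  concatMap⁺ (λ y → map (y ∷_) (allVecs n k)) (Any.map (λ { refl → ∈-map⁺ (x ∷_) (∈-allVecs v) }) (∈-allFin x))

Realises : ∀ {n} → Word → Vec (Fin n) n → Set
Realises {n} w π = Unique (toList π) × Des π ≡ prefix w (n ∸ 1)

length≤d : ∀ {n} w {πs : List (Vec (Fin n) n)} → Unique πs → All (Realises w) πs → length πs ≤ d n w
length≤d {n} w πs! realise = Unique-⊆⇒length≤ πs! λ π∈πs →
  ∈-filter⁺ (λ v → UniqueDec.unique? (Fin._≟_ {n}) (toList v) ×-dec List.≡-dec _≟ᵇ_ (Des v) (prefix w (n ∸ 1)))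
    (∈-allVecs _) (All.lookup realise π∈πs)

last-map : ∀ {A B : Set} {k} (f : A → B) (xs : Vec A (suc k)) → last (vmap f xs) ≡ f (last xs)
last-map f (x ∷ []) = refl
last-map f (x ∷ y ∷ xs) = last-map f (y ∷ xs)

Des-∷ʳ : ∀ {n k} (xs : Vec (Fin n) (suc k)) (y : Fin n) →
         Des (xs ∷ʳ y) ≡ Des xs ++ [ toℕ y <ᵇ toℕ (last xs) ]
Des-∷ʳ (x ∷ []) y = refl
Des-∷ʳ (x ∷ x′ ∷ xs) y = cong ((toℕ x′ <ᵇ toℕ x) ∷_) (Des-∷ʳ (x′ ∷ xs) y)

-- The descent bit  toℕ y <ᵇ toℕ x  is  does (y Fin.<? x)  by computation.
Des-map : ∀ {m n k} (f : Fin m → Fin n) → (∀ x y → toℕ (f x) < toℕ (f y) ⇔ toℕ x < toℕ y) →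
          (xs : Vec (Fin m) k) → Des (vmap f xs) ≡ Des xs
Des-map f f-< [] = refl
Des-map f f-< (x ∷ []) = refl
Des-map f f-< (x ∷ x′ ∷ xs) =
  cong₂ _∷_ (does-⇔ (f-< x′ x) (f x′ Fin.<? f x) (x′ Fin.<? x)) (Des-map f f-< (x′ ∷ xs))

punchIn-<⇔ : ∀ {n} (i : Fin (suc n)) (x y : Fin n) → toℕ (punchIn i x) < toℕ (punchIn i y) ⇔ toℕ x < toℕ y
punchIn-<⇔ i x y = mk⇔
  (λ ix<iy → ℕ.≰⇒> λ y≤x → ℕ.<⇒≱ ix<iy (Fin.punchIn-mono-≤ i y x y≤x))
  (λ x<y → Fin.≤∧≢⇒< (Fin.punchIn-mono-≤ i x y (ℕ.<⇒≤ x<y))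
                      (λ ix≡iy → Fin.<⇒≢ x<y (Fin.punchIn-injective i x y ix≡iy)))

map-injective : ∀ {A B : Set} {k} {f : A → B} → (∀ {x y} → f x ≡ f y → x ≡ y) →
                {xs ys : Vec A k} → vmap f xs ≡ vmap f ys → xs ≡ ys
map-injective f-inj {[]} {[]} _ = refl
map-injective f-inj {x ∷ xs} {y ∷ ys} fxs≡fys =
  cong₂ _∷_ (f-inj (Vec.∷-injectiveˡ fxs≡fys)) (map-injective f-inj (Vec.∷-injectiveʳ fxs≡fys))

extend : ∀ {n k} → Vec (Fin n) k → Fin (suc n) → Vec (Fin (suc n)) (suc k)
extend π j = vmap (punchIn j) π ∷ʳ j

last-extend : ∀ {n k} (π : Vec (Fin n) k) j → last (extend π j) ≡ j
last-extend π j = Vec.last-∷ʳ j (vmap (punchIn j) π)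

extend-injective : ∀ {n k} {π π′ : Vec (Fin n) k} j → extend π j ≡ extend π′ j → π ≡ π′
extend-injective j eq =
  map-injective (Fin.punchIn-injective j _ _) (Vec.∷ʳ-injectiveˡ (vmap (punchIn j) _) _ eq)

Unique-extend : ∀ {n k} (π : Vec (Fin n) k) j → Unique (toList π) → Unique (toList (extend π j))
Unique-extend π j π! = subst Unique (sym (trans (Vec.toList-∷ʳ j (vmap (punchIn j) π))
                                                (cong (_++ [ j ]) (Vec.toList-map (punchIn j) π))))
  (Unique.++⁺ (Unique.map⁺ (Fin.punchIn-injective j _ _) π!) ([] ∷ [])
    λ { (j∈ , here refl) → let x , _ , j≡ = ∈-map⁻ (punchIn j) j∈ in Fin.punchInᵢ≢i j x (sym j≡) })

≤ᵇ≡<ᵇsuc : ∀ m n → (m ≤ᵇ n) ≡ (m <ᵇ suc n)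
≤ᵇ≡<ᵇsuc zero n = refl
≤ᵇ≡<ᵇsuc (suc m) n = refl

<ᵇ-punchIn : ∀ {n} (j : Fin (suc n)) (x : Fin n) → (toℕ j <ᵇ toℕ (punchIn j x)) ≡ (toℕ j ≤ᵇ toℕ x)
<ᵇ-punchIn zero x = refl
<ᵇ-punchIn (suc j) zero = refl
<ᵇ-punchIn (suc j) (suc x) = trans (<ᵇ-punchIn j x) (≤ᵇ≡<ᵇsuc (toℕ j) (toℕ x))

Des-extend : ∀ {n k} (π : Vec (Fin n) (suc k)) j →
             Des (extend π j) ≡ Des π ++ [ toℕ j ≤ᵇ toℕ (last π) ]
Des-extend π j = begin
  Des (vmap (punchIn j) π ∷ʳ j)
    ≡⟨ Des-∷ʳ (vmap (punchIn j) π) j ⟩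
  Des (vmap (punchIn j) π) ++ [ toℕ j <ᵇ toℕ (last (vmap (punchIn j) π)) ]
    ≡⟨ cong₂ (λ bs x → bs ++ [ toℕ j <ᵇ toℕ x ]) (Des-map (punchIn j) (punchIn-<⇔ j) π) (last-map (punchIn j) π) ⟩
  Des π ++ [ toℕ j <ᵇ toℕ (punchIn j (last π)) ]
    ≡⟨ cong (λ b → Des π ++ [ b ]) (<ᵇ-punchIn j (last π)) ⟩
  Des π ++ [ toℕ j ≤ᵇ toℕ (last π) ] ∎
  where open ≡-Reasoning

room : ∀ {n} → Bool → Fin (suc n) → ℕ
room true ℓ = toℕ ℓ
room {n} false ℓ = n ∸ toℕ ℓ

toℕ≤n : ∀ {n} (ℓ : Fin (suc n)) → toℕ ℓ ≤ n
toℕ≤n ℓ = s≤s⁻¹ (Fin.toℕ<n ℓ)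

room≤ : ∀ {n} x (ℓ : Fin (suc n)) → room x ℓ ≤ n
room≤ true ℓ = toℕ≤n ℓ
room≤ {n} false ℓ = ℕ.m∸n≤m n (toℕ ℓ)

clamp : ∀ {n} → ℕ → Fin (suc n)
clamp {n} m = fromℕ< (s≤s (ℕ.m⊓n≤n m n))

toℕ-clamp : ∀ {m n} → m ≤ n → toℕ (clamp {n} m) ≡ m
toℕ-clamp m≤n = trans (Fin.toℕ-fromℕ< _) (ℕ.m≤n⇒m⊓n≡m m≤n)

entry : ∀ {n} → Bool → ℕ → Fin (suc n)
entry true γ = clamp γ
entry {n} false γ = clamp (n ∸ γ)

room-entry : ∀ {n} y {γ} → γ ≤ n → room {n} y (entry y γ) ≡ γ
room-entry true γ≤n = toℕ-clamp γ≤n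
room-entry {n} false {γ} γ≤n = trans (cong (n ∸_) (toℕ-clamp (ℕ.m∸n≤m n γ))) (ℕ.m∸[m∸n]≡n γ≤n)

entry-same : ∀ {n} y {γ} (ℓ : Fin (suc n)) → γ ≤ room y ℓ → (toℕ (entry {suc n} y γ) ≤ᵇ toℕ ℓ) ≡ y
entry-same true ℓ γ≤ℓ = dec-true (_ ℕ.≤? _)
  (subst (_≤ toℕ ℓ) (sym (toℕ-clamp (ℕ.≤-trans γ≤ℓ (ℕ.≤-trans (toℕ≤n ℓ) (ℕ.n≤1+n _))))) γ≤ℓ)
entry-same {n} false {γ} ℓ γ≤room = dec-false (_ ℕ.≤? _)
  (ℕ.<⇒≱ (subst (toℕ ℓ <_) (sym (toℕ-clamp (ℕ.m∸n≤m (suc n) γ))) ℓ<1+n∸γ))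
  where
  ℓ<1+n∸γ : toℕ ℓ < suc n ∸ γ
  ℓ<1+n∸γ = ℕ.m+n≤o⇒m≤o∸n (suc (toℕ ℓ))
    (s≤s (subst (_≤ n) (ℕ.+-comm γ (toℕ ℓ)) (ℕ.m≤o∸n⇒m+n≤o γ (toℕ≤n ℓ) γ≤room)))

entry-opposite : ∀ {n} x {γ} (ℓ : Fin (suc n)) → γ ≤ suc n → suc n ∸ γ ≤ room x ℓ →
                 (toℕ (entry {suc n} (not x) γ) ≤ᵇ toℕ ℓ) ≡ x
entry-opposite {n} true {γ} ℓ _ h = dec-true (_ ℕ.≤? _)
  (subst (_≤ toℕ ℓ) (sym (toℕ-clamp (ℕ.m∸n≤m (suc n) γ))) h)
entry-opposite {n} false {γ} ℓ γ≤1+n h = dec-false (_ ℕ.≤? _) λ γ≤ℓ →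
  ℕ.n≮n (n ∸ toℕ ℓ) (begin-strict
    n ∸ toℕ ℓ         <⟨ ℕ.n<1+n _ ⟩
    suc (n ∸ toℕ ℓ)   ≡⟨ ℕ.+-∸-assoc 1 (toℕ≤n ℓ) ⟨
    suc n ∸ toℕ ℓ     ≤⟨ ℕ.∸-monoʳ-≤ (suc n) (subst (_≤ toℕ ℓ) (toℕ-clamp γ≤1+n) γ≤ℓ) ⟩
    suc n ∸ γ         ≤⟨ h ⟩
    n ∸ toℕ ℓ         ∎)
  where open ℕ.≤-Reasoning

-- The room a child gets. While the letter repeats it can be kept at δ + g; at a change of letter
-- the new entry can be taken extreme, which gives (almost) maximal room.
target : Bool → Bool → (n g δ : ℕ) → ℕ
target true  true  n g δ = δ + g
target false false n g δ = δ + g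
target true  false n g δ = suc n ∸ δ
target false true  n g δ = suc n ∸ δ

target-0≢1 : ∀ x y n g → target x y n g 0 ≢ target x y n g 1
target-0≢1 true  true  n g = ℕ.<⇒≢ (ℕ.n<1+n g)
target-0≢1 false false n g = ℕ.<⇒≢ (ℕ.n<1+n g)
target-0≢1 true  false n g = ℕ.>⇒≢ (ℕ.n<1+n n)
target-0≢1 false true  n g = ℕ.>⇒≢ (ℕ.n<1+n n)

same-fits : ∀ {n} x {g δ} (ℓ : Fin (suc n)) → δ + g ≤ room x ℓ →
            (toℕ (entry {suc n} x (δ + g)) ≤ᵇ toℕ ℓ) ≡ x × δ + g ≤ suc n × g ≤ δ + g
same-fits {n} x {g} {δ} ℓ h =
  entry-same x ℓ h , ℕ.≤-trans h (ℕ.≤-trans (room≤ x ℓ) (ℕ.n≤1+n n)) , ℕ.m≤n+m g δ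

opposite-fits : ∀ {n} x {g δ} (ℓ : Fin (suc n)) → δ + g ≤ room x ℓ →
                (toℕ (entry {suc n} (not x) (suc n ∸ δ)) ≤ᵇ toℕ ℓ) ≡ x × suc n ∸ δ ≤ suc n × g ≤ suc n ∸ δ
opposite-fits {n} x {g} {δ} ℓ h =
  entry-opposite x ℓ (ℕ.m∸n≤m (suc n) δ)
    (subst (_≤ room x ℓ) (sym (ℕ.m∸[m∸n]≡n δ≤1+n)) (ℕ.≤-trans (ℕ.m≤m+n δ g) h))
  , ℕ.m∸n≤m (suc n) δ
  , ℕ.m+n≤o⇒m≤o∸n g (subst (_≤ suc n) (ℕ.+-comm δ g) (ℕ.≤-trans δ+g≤n (ℕ.n≤1+n n)))
  where
  δ+g≤n : δ + g ≤ n
  δ+g≤n = ℕ.≤-trans h (room≤ x ℓ)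
  δ≤1+n : δ ≤ suc n
  δ≤1+n = ℕ.≤-trans (ℕ.m≤m+n δ g) (ℕ.≤-trans δ+g≤n (ℕ.n≤1+n n))

entry-fits : ∀ {n} x y g δ (ℓ : Fin (suc n)) → δ + g ≤ room x ℓ →
             (toℕ (entry {suc n} y (target x y n g δ)) ≤ᵇ toℕ ℓ) ≡ x
             × target x y n g δ ≤ suc n × g ≤ target x y n g δ
entry-fits true  true  g δ ℓ h = same-fits true ℓ h
entry-fits false false g δ ℓ h = same-fits false ℓ h
entry-fits true  false g δ ℓ h = opposite-fits true ℓ h
entry-fits false true  g δ ℓ h = opposite-fits false ℓ h

prefix-suc : ∀ w n → prefix w (suc n) ≡ prefix w n ++ [ w n ]
prefix-suc w n = trans (cong (map w) (sym (List.upTo-∷ʳ n))) (List.map-++ w (upTo n) [ n ])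

extend-realises : ∀ {n} w {π : Vec (Fin (suc n)) (suc n)} {j} →
                  Realises w π → (toℕ j ≤ᵇ toℕ (last π)) ≡ w n → Realises w (extend π j)
extend-realises {n} w {π} {j} (π! , Des-π) bit =
  Unique-extend π j π! , (begin
    Des (extend π j)                        ≡⟨ Des-extend π j ⟩
    Des π ++ [ toℕ j ≤ᵇ toℕ (last π) ]      ≡⟨ cong₂ (λ bs b → bs ++ [ b ]) Des-π bit ⟩
    prefix w n ++ [ w n ]                   ≡⟨ prefix-suc w n ⟨
    prefix w (suc n)                        ∎)
  where open ≡-Reasoning

-- w n is the letter that follows Des π = w[n].
Admissible : ∀ {n} → Word → ℕ → Vec (Fin (suc n)) (suc n) → Set
Admissible {n} w g π = Realises w π × g ≤ room (w n) (last π)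

Admissible-mono : ∀ {n} w {g g′} {π : Vec (Fin (suc n)) (suc n)} → g′ ≤ g → Admissible w g π → Admissible w g′ π
Admissible-mono w g′≤g (realises , g≤room) = realises , ℕ.≤-trans g′≤g g≤room

child : ∀ {n} → Word → (g δ : ℕ) → Vec (Fin (suc n)) (suc n) → Vec (Fin (suc (suc n))) (suc (suc n))
child {n} w g δ π = extend π (entry (w (suc n)) (target (w n) (w (suc n)) n g δ))

module _ {n} (w : Word) (g δ : ℕ) {π : Vec (Fin (suc n)) (suc n)} (admissible : Admissible w (δ + g) π) where

  private
    γ : ℕ
    γ = target (w n) (w (suc n)) n g δ

    fits : (toℕ (entry {suc n} (w (suc n)) γ) ≤ᵇ toℕ (last π)) ≡ w n × γ ≤ suc n × g ≤ γ
    fits = entry-fits (w n) (w (suc n)) g δ (last π) (proj₂ admissible)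

  room-child : room (w (suc n)) (last (child w g δ π)) ≡ target (w n) (w (suc n)) n g δ
  room-child = trans (cong (room (w (suc n))) (last-extend π _)) (room-entry (w (suc n)) (proj₁ (proj₂ fits)))

  child-admissible : Admissible w g (child w g δ π)
  child-admissible = extend-realises w (proj₁ admissible) (proj₁ fits) , subst (g ≤_) (sym room-child) (proj₂ (proj₂ fits))

module PascalGrowth (f : ℕ → ℕ → ℕ) (K : ℕ)
  (f-step : ∀ m g → f m g + f m (suc g) ≤ f (suc m) g)
  (f-base : ∀ g → g ≤ K → 1 ≤ f 0 g) where

  f-mono : ∀ {m m′} g → m ≤′ m′ → f m g ≤ f m′ g
  f-mono g ≤′-refl = ℕ.≤-refl
  f-mono g (≤′-step m≤′m′) = ℕ.≤-trans (f-mono g m≤′m′) (ℕ.m+n≤o⇒m≤o _ (f-step _ g))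

  linear-growth : ∀ D m g → D * f m (suc g) ≤ f (D + m) g
  linear-growth zero m g = z≤n
  linear-growth (suc D) m g = begin
    f m (suc g) + D * f m (suc g)      ≤⟨ ℕ.+-mono-≤ (f-mono (suc g) (ℕ.≤⇒≤′ (ℕ.m≤n+m m D))) (linear-growth D m g) ⟩
    f (D + m) (suc g) + f (D + m) g    ≡⟨ ℕ.+-comm (f (D + m) (suc g)) _ ⟩
    f (D + m) g + f (D + m) (suc g)    ≤⟨ f-step (D + m) g ⟩
    f (suc D + m) g                    ∎
    where open ℕ.≤-Reasoning

  polynomial-growth : ∀ r g D m → g + r ≤ K → r * D ≤ m → D ^ r ≤ f m g
  polynomial-growth zero g D m g≤K _ = ℕ.≤-trans (f-base g (ℕ.m+n≤o⇒m≤o g g≤K)) (f-mono g (ℕ.≤⇒≤′ z≤n))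
  polynomial-growth (suc r) g D m g+r+1≤K r+1*D≤m = begin
    D * D ^ r               ≤⟨ ℕ.*-monoʳ-≤ D (polynomial-growth r (suc g) D (r * D) g+1+r≤K ℕ.≤-refl) ⟩
    D * f (r * D) (suc g)   ≤⟨ linear-growth D (r * D) g ⟩
    f (D + r * D) g         ≤⟨ f-mono g (ℕ.≤⇒≤′ r+1*D≤m) ⟩
    f m g                   ∎
    where
    open ℕ.≤-Reasoning
    g+1+r≤K : suc g + r ≤ K
    g+1+r≤K = subst (_≤ K) (ℕ.+-suc g r) g+r+1≤K

module Family (w : Word) {n₀} (π₀ : Vec (Fin (suc n₀)) (suc n₀)) (K : ℕ) (π₀-admissible : Admissible w K π₀) where

  Level : ℕ → Set
  Level m = Vec (Fin (suc (m + n₀))) (suc (m + n₀))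

  family : (m g : ℕ) → List (Level m)
  family zero g = if g ≤ᵇ K then [ π₀ ] else []
  family (suc m) g = map (child w g 0) (family m g) ++ map (child w g 1) (family m (suc g))

  family-admissible : ∀ m g → All (Admissible w g) (family m g)
  family-admissible zero g with g ≤ᵇ K | ℕ.≤ᵇ-reflects-≤ g K
  ... | true  | ofʸ g≤K = Admissible-mono w g≤K π₀-admissible ∷ []
  ... | false | _       = []
  family-admissible (suc m) g = ++⁺ (map⁺ (All.map (child-admissible w g 0) (family-admissible m g)))
                                    (map⁺ (All.map (child-admissible w g 1) (family-admissible m (suc g))))

  family-unique : ∀ m g → Unique (family m g)
  family-unique zero g with g ≤ᵇ K
  ... | true  = [] ∷ []
  ... | false = []
  family-unique (suc m) g = Unique.++⁺ (Unique.map⁺ (extend-injective _) (family-unique m g))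
                                       (Unique.map⁺ (extend-injective _) (family-unique m (suc g)))
                                       children-disjoint
    where
    children-disjoint : Disjoint (map (child w g 0) (family m g)) (map (child w g 1) (family m (suc g)))
    children-disjoint (v∈₀ , v∈₁) with ∈-map⁻ (child w g 0) v∈₀ | ∈-map⁻ (child w g 1) v∈₁
    ... | π , π∈ , refl | π′ , π′∈ , π₀≡π′₁ = target-0≢1 (w (m + n₀)) next (m + n₀) g (begin
      target (w (m + n₀)) next (m + n₀) g 0   ≡⟨ room-child w g 0 (All.lookup (family-admissible m g) π∈) ⟨
      room next (last (child w g 0 π))        ≡⟨ cong (λ v → room next (last v)) π₀≡π′₁ ⟩
      room next (last (child w g 1 π′))       ≡⟨ room-child w g 1 (All.lookup (family-admissible m (suc g)) π′∈) ⟩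
      target (w (m + n₀)) next (m + n₀) g 1   ∎)
      where
      open ≡-Reasoning
      next : Bool
      next = w (suc (m + n₀))

  length-family-suc : ∀ m g → length (family (suc m) g) ≡ length (family m g) + length (family m (suc g))
  length-family-suc m g = trans (List.length-++ (map (child w g 0) (family m g)))
    (cong₂ _+_ (List.length-map _ (family m g)) (List.length-map _ (family m (suc g))))

  length-family-zero : ∀ g → g ≤ K → 1 ≤ length (family 0 g)
  length-family-zero g g≤K with g ≤ᵇ K | ℕ.≤ᵇ-reflects-≤ g K
  ... | true  | _       = ℕ.≤-refl
  ... | false | ofⁿ g≰K = contradiction g≤K g≰K

  open PascalGrowth (λ m g → length (family m g)) K (λ m g → ℕ.≤-reflexive (sym (length-family-suc m g)))
                    length-family-zero

  pow≤d : ∀ r g D m → g + r ≤ K → r * D ≤ m → D ^ r ≤ d (suc (m + n₀)) w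
  pow≤d r g D m g+r≤K rD≤m = ℕ.≤-trans (polynomial-growth r g D m g+r≤K rD≤m)
    (length≤d w (family-unique m g) (All.map proj₁ (family-admissible m g)))

module _ (w : Word) where

  -- Each new entry is an extreme value, so the room for the opposite letter is maximal.
  greedy : (u : ℕ) → Vec (Fin (suc u)) (suc u)
  greedy zero = zero ∷ []
  greedy (suc u) = extend (greedy u) (entry (not (w u)) (suc u))

  greedy-realises : ∀ u → Realises w (greedy u)
  greedy-realises zero = ([] ∷ []) , refl
  greedy-realises (suc u) = extend-realises w (greedy-realises u)
    (entry-opposite (w u) (last (greedy u)) ℕ.≤-refl (subst (_≤ room (w u) (last (greedy u))) (sym (ℕ.n∸n≡0 u)) z≤n))

  greedy-admissible : ∀ t → w (suc t) ≡ not (w t) → Admissible w (suc t) (greedy (suc t))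
  greedy-admissible t switch = greedy-realises (suc t) , ℕ.≤-reflexive (sym (begin
    room (w (suc t)) (last (greedy (suc t)))                         ≡⟨ cong (λ x → room x (last (greedy (suc t)))) switch ⟩
    room (not (w t)) (last (greedy (suc t)))                         ≡⟨ cong (room (not (w t))) (last-extend (greedy t) _) ⟩
    room (not (w t)) (entry {suc t} (not (w t)) (suc t))             ≡⟨ room-entry (not (w t)) ℕ.≤-refl ⟩
    suc t                                                            ∎))
    where open ≡-Reasoning

switch-between : ∀ {A : Set} → DecidableEquality A → (f : ℕ → A) → ∀ k e →
                 f k ≢ f (e + k) → ∃ λ t → k ≤ t × f t ≢ f (suc t)
switch-between _≟_ f k zero fk≢fk = contradiction refl fk≢fk
switch-between _≟_ f k (suc e) fk≢ with f k ≟ f (suc k)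
... | no fk≢fk+1 = k , ℕ.≤-refl , fk≢fk+1
... | yes fk≡fk+1 with switch-between _≟_ f (suc k) e (λ eq → fk≢ (trans fk≡fk+1 (trans eq (cong f (ℕ.+-suc e k)))))
...   | t , k<t , switch = t , ℕ.<⇒≤ k<t , switch

switch-beyond : ∀ w → InfinitelyMany false w → InfinitelyMany true w →
                ∀ a → ∃ λ t → a ≤ t × w (suc t) ≡ not (w t)
switch-beyond w zeros ones a with zeros a
... | k₀ , a≤k₀ , wk₀≡0 with ones k₀
...   | k₁ , k₀≤k₁ , wk₁≡1 with switch-between _≟ᵇ_ w k₀ (k₁ ∸ k₀)
                                 (subst (λ k → w k₀ ≢ w k) (sym (ℕ.m∸n+n≡m k₀≤k₁))
                                        (subst₂ _≢_ (sym wk₀≡0) (sym wk₁≡1) λ ()))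
...     | t , k₀≤t , switch = t , ℕ.≤-trans a≤k₀ k₀≤t , ¬-not (switch ∘ sym)

^-distribʳ-* : ∀ m n o → (m * n) ^ o ≡ m ^ o * n ^ o
^-distribʳ-* m n zero = refl
^-distribʳ-* m n (suc o) = trans (cong (m * n *_) (^-distribʳ-* m n o)) (*-interchange m n (m ^ o) (n ^ o))

m≤m^n : ∀ m {n} → 0 < n → m ≤ m ^ n
m≤m^n zero {suc n} _ = z≤n
m≤m^n (suc m) {suc n} _ = ℕ.m≤m*n (suc m) (suc m ^ n) {{ℕ.m^n≢0 (suc m) n}}

^<^-suc : ∀ a {x D E} → x ≤ D * E → E ^ a < D → x ^ a < D ^ suc a
^<^-suc a {x} {D} {E} x≤DE Eᵃ<D = begin-strict
  x ^ a              ≤⟨ ℕ.^-monoˡ-≤ a x≤DE ⟩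
  (D * E) ^ a        ≡⟨ ^-distribʳ-* D E a ⟩
  D ^ a * E ^ a      <⟨ ℕ.*-monoʳ-< (D ^ a) {{ℕ.m^n≢0 D a {{>-nonZero (ℕ.≤-<-trans z≤n Eᵃ<D)}}}} Eᵃ<D ⟩
  D ^ a * D          ≡⟨ ℕ.*-comm (D ^ a) D ⟩
  D ^ suc a          ∎
  where open ℕ.≤-Reasoning

m≤m/n*n+[n∸1] : ∀ m a → m ≤ m / suc a * suc a + a
m≤m/n*n+[n∸1] m a = begin
  m                              ≡⟨ m≡m%n+[m/n]*n m (suc a) ⟩
  m % suc a + m / suc a * suc a  ≤⟨ ℕ.+-monoˡ-≤ _ (s≤s⁻¹ (m%n<n m (suc a))) ⟩
  a + m / suc a * suc a          ≡⟨ ℕ.+-comm a _ ⟩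
  m / suc a * suc a + a          ∎
  where open ℕ.≤-Reasoning

-- The threshold B makes D = m / (1 + a) absorb both the remainder a + c and the constant (a + 2) ^ a.
pow<[m/n]^n : ∀ a c → ∃ λ N → ∀ m → N ≤ m → (m + c) ^ a < (m / suc a) ^ suc a
pow<[m/n]^n a c = B * suc a , bound
  where
  E B : ℕ
  E = suc (suc a)
  B = a + c + suc (E ^ a)

  bound : ∀ m → B * suc a ≤ m → (m + c) ^ a < (m / suc a) ^ suc a
  bound m B*[1+a]≤m = ^<^-suc a m+c≤D*E (ℕ.≤-trans (ℕ.m≤n+m _ (a + c)) B≤D)
    where
    open ℕ.≤-Reasoning
    D : ℕ
    D = m / suc a

    B≤D : B ≤ D
    B≤D = subst (_≤ D) (m*n/n≡m B (suc a)) (/-monoˡ-≤ (suc a) B*[1+a]≤m)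

    m+c≤D*E : m + c ≤ D * E
    m+c≤D*E = begin
      m + c                          ≤⟨ ℕ.+-monoˡ-≤ c (m≤m/n*n+[n∸1] m a) ⟩
      D * suc a + a + c              ≡⟨ ℕ.+-assoc (D * suc a) a c ⟩
      D * suc a + (a + c)            ≤⟨ ℕ.+-monoʳ-≤ (D * suc a) (ℕ.≤-trans (ℕ.m≤m+n (a + c) _) B≤D) ⟩
      D * suc a + D                  ≡⟨ ℕ.+-comm (D * suc a) D ⟩
      D + D * suc a                  ≡⟨ ℕ.*-suc D (suc a) ⟨
      D * E                          ∎

d-lower-bound : ∀ w {a t} → a ≤ t → w (suc t) ≡ not (w t) →
                ∀ m → (m / suc a) ^ suc a ≤ d (m + suc (suc t)) w
d-lower-bound w {a} {t} a≤t switch m =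
  subst (λ n → (m / suc a) ^ suc a ≤ d n w) (sym (ℕ.+-suc m (suc t)))
    (pow≤d (suc a) (t ∸ a) (m / suc a) m
      (ℕ.≤-reflexive (trans (ℕ.+-suc (t ∸ a) a) (cong suc (ℕ.m∸n+n≡m a≤t))))
      (subst (_≤ m) (ℕ.*-comm (m / suc a) (suc a)) (m/n*n≤m m (suc a))))
  where open Family w (greedy w (suc t)) (suc t) (greedy-admissible w t switch)

proposition3p8 : (w : Word) → InfinitelyMany false w → InfinitelyMany true w →
    (a b : ℕ) → 0 < a → 0 < b →
    ∃ λ N → ∀ n → N ≤ n → n ^ a < d n w ^ b
proposition3p8 w zeros ones a b _ 0<b with switch-beyond w zeros ones a
... | t , a≤t , switch with pow<[m/n]^n a (suc (suc t))
...   | N , bound = N + c , eventually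
  where
  c : ℕ
  c = suc (suc t)

  eventually : ∀ n → N + c ≤ n → n ^ a < d n w ^ b
  eventually n N+c≤n = begin-strict
    n ^ a                        ≡⟨ cong (_^ a) m+c≡n ⟨
    (m + c) ^ a                  <⟨ bound m (subst (_≤ m) (ℕ.m+n∸n≡m N c) (ℕ.∸-monoˡ-≤ c N+c≤n)) ⟩
    (m / suc a) ^ suc a          ≤⟨ d-lower-bound w a≤t switch m ⟩
    d (m + c) w                  ≡⟨ cong (λ k → d k w) m+c≡n ⟩
    d n w                        ≤⟨ m≤m^n (d n w) 0<b ⟩
    d n w ^ b                    ∎
    where
    open ℕ.≤-Reasoning
    m : ℕ
    m = n ∸ c
    m+c≡n : m + c ≡ n
    m+c≡n = ℕ.m∸n+n≡m (ℕ.≤-trans (ℕ.m≤n+m c N) N+c≤n)
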